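{- Let $R$ be a nonempty set of permutations, and let $Rn$ be the set of permutations obtained from the elements $\sigma \in R$ by appending the entry $|\sigma|+1$ at the end. Set $$P(x) = \sum_{n=0}^\infty |\mathfrak{S}_n(1243,2143,R)|\,x^n, \qquad Q(x) = \sum_{n=0}^\infty |\mathfrak{S}_n(1243,2143,Rn)|\,x^n.$$ Then $$Q(x) = \frac{2-P(x)}{2-x-P(x)}.$$
   Context: $\mathfrak{S}_n(S)$ is the set of permutations of $\{1,\dots,n\}$ containing no subsequence with the same relative order as any pattern in $S$; $\mathfrak{S}_n(1243,2143,R)$ means avoidance of $1243$, $2143$ and every element of $R$. $|\sigma|$ denotes the length of $\sigma$ (e.g. if $R = \{42531, 4231, 312\}$ then $Rn = \{425316, 42315, 3124\}$). -}

module Defs where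

open import Data.Nat using (ℕ; zero; suc; _<_; _∸_)
open import Data.Integer as ℤ using (ℤ; +_)
open import Data.List using (List; []; _∷_; length; lookup; map; upTo; _++_; foldr)
open import Data.List.Relation.Binary.Permutation.Propositional using (_↭_)
open import Data.List.Relation.Binary.Sublist.Propositional using (_⊆_)
open import Data.List.Relation.Unary.Unique.Propositional using (Unique)
open import Data.List.Membership.Propositional using (_∈_)
open import Data.Fin using (Fin; cast)
open import Data.Product using (Σ; ∃; _×_)
open import Data.Sum using (_⊎_)
open import Relation.Binary.PropositionalEquality using (_≡_)
open import Relation.Nullary using (¬_)
open import Function.Bundles using (_⇔_)

IsPerm : List ℕ → Set
IsPerm σ = σ ↭ map suc (upTo (length σ))

OrderIso : List ℕ → List ℕ → Set
OrderIso τ π =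
  Σ (length τ ≡ length π) λ eq →
    ∀ (i j : Fin (length τ)) →
      (lookup τ i < lookup τ j) ⇔ (lookup π (cast eq i) < lookup π (cast eq j))

Contains : List ℕ → List ℕ → Set
Contains σ π = ∃ λ τ → (τ ⊆ σ) × OrderIso τ π

Avoids : (List ℕ → Set) → List ℕ → Set
Avoids S σ = ∀ π → S π → ¬ Contains σ π

Av : (List ℕ → Set) → ℕ → List ℕ → Set
Av S n σ = IsPerm σ × length σ ≡ n × Avoids S σ

With1243-2143 : (List ℕ → Set) → List ℕ → Set
With1243-2143 R π = (π ≡ 1 ∷ 2 ∷ 4 ∷ 3 ∷ []) ⊎ (π ≡ 2 ∷ 1 ∷ 4 ∷ 3 ∷ []) ⊎ R π

AppendMax : (List ℕ → Set) → List ℕ → Set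
AppendMax R π = ∃ λ σ → R σ × π ≡ σ ++ (suc (length σ) ∷ [])

HasCard : (List ℕ → Set) → ℕ → Set
HasCard P N = ∃ λ xs → length xs ≡ N × Unique xs × (∀ σ → (σ ∈ xs) ⇔ P σ)

FPS : Set
FPS = ℕ → ℤ

_⊕_ : FPS → FPS → FPS
(f ⊕ g) n = f n ℤ.+ g n

_⊖_ : FPS → FPS → FPS
(f ⊖ g) n = f n ℤ.- g n

_⊛_ : FPS → FPS → FPS
(f ⊛ g) n = foldr ℤ._+_ (+ 0) (map (λ k → f k ℤ.* g (n ∸ k)) (upTo (suc n)))

constS : ℤ → FPS
constS c zero = c
constS c (suc _) = + 0

X : FPS
X (suc zero) = + 1
X _ = + 0

gf : (ℕ → ℕ) → FPS
gf a n = + a n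

-- Write σ ∈ 𝔖_{n+1}(1243, 2143, Rn) as α (n+1) β. If α is empty, β is an arbitrary element of
-- 𝔖_n(1243, 2143, Rn). Otherwise let m = |β| + 1. An entry z > m of β would leave two entries
-- x₁, x₂ ≤ m in α, and x₁ x₂ (n+1) z is a 1243 or a 2143; so β ⊆ [1, m] and exactly one entry c
-- of α is ≤ m. Then c β ∈ 𝔖_m(1243, 2143, Rn), and α, standardised, lies in 𝔖_{n+1-m}(1243, 2143, R),
-- since an occurrence of r in α followed by n+1 is an occurrence of r (|r|+1). Conversely, every such
-- pair (α, c β) arises from exactly one σ. Hence q_{n+1} = q_n + Σ_{j=1}^{n} q_j p_{n+1-j} with
-- p₀ = q₀ = 1, which is the coefficientwise form of Q (2 - x - P) = 2 - P.

module Submission where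

open import Data.Empty using (⊥; ⊥-elim)
open import Data.Fin using (zero; suc; cast)
open import Data.Fin.Properties using (toℕ-cast; toℕ-injective)
open import Data.Integer using (+_)
open import Data.List using (List; []; _∷_; [_]; _++_; length; lookup; map; filter; foldr; applyUpTo; upTo)
open import Data.List.Membership.Propositional using (_∈_; _∉_; find)
open import Data.List.Membership.Propositional.Properties using (∈-++⁻; ∈-++⁺ˡ; ∈-++⁺ʳ; ∈-map⁺; ∈-map⁻; ∈-filter⁺; ∈-filter⁻; ∈-∃++; ∈-upTo⁻)
open import Data.List.Membership.Propositional.Properties.WithK using (unique∧set⇒bag)
open import Data.List.Properties using (∷-injective; ++-assoc; ++-identityʳ; length-++; length-map; map-++; map-∘; map-id-local; map-upTo; applyUpTo-∷ʳ; reverse-++; filter-++; filter-all; filter-none; filter-accept; filter-reject; filter-notAll)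
open import Data.List.Relation.Binary.BagAndSetEquality using (∼bag⇒↭)
open import Data.List.Relation.Binary.Permutation.Propositional using (_↭_; ↭-refl; ↭-sym; ↭-trans; ↭-prep; ↭-reflexive; ↭⇒↭ₛ; module PermutationReasoning)
open import Data.List.Relation.Binary.Permutation.Propositional.Properties using (All-resp-↭; ∈-resp-↭; ↭-length; ↭-empty-inv; ↭-singleton-inv; ∷↭∷ʳ; ++⁺ˡ; ++⁺ʳ; ++-comm; shift; shifts; drop-∷; map⁺; filter-↭)
open import Data.List.Relation.Binary.Pointwise using (Pointwise; []; _∷_; lookup⁻)
import Data.List.Relation.Binary.Pointwise as Pointwise
open import Data.List.Relation.Binary.Pointwise.Properties using (lookup-cast)
open import Data.List.Relation.Binary.Sublist.Propositional using (_⊆_; []; _∷_; _∷ʳ_; ⊆-refl; ⊆-trans; from∈)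
import Data.List.Relation.Binary.Sublist.Propositional.Properties as Sublist
open import Data.List.Relation.Unary.All using (All; []; _∷_; all?)
import Data.List.Relation.Unary.All as All
import Data.List.Relation.Unary.All.Properties as All
open import Data.List.Relation.Unary.AllPairs using ([]; _∷_)
open import Data.List.Relation.Unary.Any using (Any; here; there)
open import Data.List.Relation.Unary.Unique.Propositional using (Unique)
open import Data.List.Relation.Unary.Unique.Propositional.Properties using (++⁺)
open import Data.Nat using (ℕ; zero; suc; pred; _+_; _*_; _∸_; _≤_; _<_; z≤n; s≤s; _<?_; _≤?_; >-nonZero)
open import Data.Nat.ListAction using (sum)
open import Data.Nat.ListAction.Properties using (sum-++)
open import Data.Nat.Properties
open import Data.Product using (∃; ∃₂; _×_; _,_; proj₁; proj₂)
open import Data.Sum using (_⊎_; inj₁; inj₂)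
import Data.Sum as Sum
open import Function using (_∘_; id)
open import Function.Bundles using (_⇔_; mk⇔; Equivalence)
open import Function.Properties.Equivalence using () renaming (trans to ⇔-trans; sym to ⇔-sym)
open import Relation.Binary.Definitions using (tri<; tri≈; tri>)
open import Relation.Binary.PropositionalEquality hiding ([_])
open import Relation.Binary.PropositionalEquality.Properties using (setoid)
open import Data.List.Relation.Binary.Permutation.Setoid.Properties (setoid ℕ) using (Unique-resp-↭)
open import Relation.Nullary using (¬_; yes; no)
open import Relation.Nullary.Decidable using (True; toWitness)
open import Relation.Unary using (Decidable)

open import Defs

open Equivalence using (to; from)

-- Order isomorphism and pattern containment

SameComparison : ℕ → ℕ → ℕ → ℕ → Set
SameComparison x y x′ y′ = (x < x′ ⇔ y < y′) × (x′ < x ⇔ y′ < y)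

SameComparison-< : ∀ {x y x′ y′} → x < x′ → y < y′ → SameComparison x y x′ y′
SameComparison-< x<x′ y<y′ = mk⇔ (λ _ → y<y′) (λ _ → x<x′) , mk⇔ (⊥-elim ∘ <-asym x<x′) (⊥-elim ∘ <-asym y<y′)

SameComparison-> : ∀ {x y x′ y′} → x′ < x → y′ < y → SameComparison x y x′ y′
SameComparison-> x′<x y′<y = mk⇔ (⊥-elim ∘ <-asym x′<x) (⊥-elim ∘ <-asym y′<y) , mk⇔ (λ _ → y′<y) (λ _ → x′<x)

SameComparison-self : ∀ {x y} → SameComparison x y x y
SameComparison-self = irrefl⇔ , irrefl⇔
  where
  irrefl⇔ : ∀ {x y} → (x < x) ⇔ (y < y)
  irrefl⇔ = mk⇔ (⊥-elim ∘ <-irrefl refl) (⊥-elim ∘ <-irrefl refl)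

infix 4 _≅_

data _≅_ : List ℕ → List ℕ → Set where
  [] : [] ≅ []
  _∷_ : ∀ {x y xs ys} → Pointwise (SameComparison x y) xs ys → xs ≅ ys → x ∷ xs ≅ y ∷ ys

≅-length : ∀ {xs ys} → xs ≅ ys → length xs ≡ length ys
≅-length [] = refl
≅-length (_ ∷ iso) = cong suc (≅-length iso)

OrderIso⇒≅ : ∀ τ π → OrderIso τ π → τ ≅ π
OrderIso⇒≅ [] [] _ = []
OrderIso⇒≅ (x ∷ xs) (y ∷ ys) (eq , cmp) =
  lookup⁻ (suc-injective eq) (λ {i} {j} i≡j → subst (λ j → SameComparison x y _ (lookup ys j))
     (toℕ-injective (trans (toℕ-cast _ i) i≡j)) (cmp zero (suc i) , cmp (suc i) zero))
  ∷ OrderIso⇒≅ xs ys (suc-injective eq , λ i j → cmp (suc i) (suc j))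

≅⇒OrderIso : ∀ {τ π} → τ ≅ π → OrderIso τ π
≅⇒OrderIso iso = ≅-length iso , compare iso (≅-length iso)
  where
  compare : ∀ {τ π} → τ ≅ π → (eq : length τ ≡ length π) → ∀ i j →
    (lookup τ i < lookup τ j) ⇔ (lookup π (cast eq i) < lookup π (cast eq j))
  compare (_ ∷ _) eq zero zero = proj₁ SameComparison-self
  compare (cmps ∷ _) eq zero (suc j) = proj₁ (lookup-cast cmps (suc-injective eq) j)
  compare (cmps ∷ _) eq (suc i) zero = proj₂ (lookup-cast cmps (suc-injective eq) i)
  compare (_ ∷ iso) eq (suc i) (suc j) = compare iso (suc-injective eq) i j

≅-trans : ∀ {xs ys zs} → xs ≅ ys → ys ≅ zs → xs ≅ zs
≅-trans [] [] = []
≅-trans (c ∷ p) (d ∷ q) =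
  Pointwise.transitive (λ (a , b) (a′ , b′) → ⇔-trans a a′ , ⇔-trans b b′) c d ∷ ≅-trans p q

≅-sym : ∀ {xs ys} → xs ≅ ys → ys ≅ xs
≅-sym [] = []
≅-sym (c ∷ p) = Pointwise.symmetric (λ (a , b) → ⇔-sym a , ⇔-sym b) c ∷ ≅-sym p

Pointwise-++⁻ : ∀ {R : ℕ → ℕ → Set} xs ys {xs′ ys′} → length xs ≡ length ys →
  Pointwise R (xs ++ xs′) (ys ++ ys′) → Pointwise R xs ys × Pointwise R xs′ ys′
Pointwise-++⁻ [] [] _ rs = [] , rs
Pointwise-++⁻ (_ ∷ xs) (_ ∷ ys) eq (r ∷ rs) with Pointwise-++⁻ xs ys (suc-injective eq) rs
... | rs₁ , rs₂ = r ∷ rs₁ , rs₂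

≅-++-max : ∀ {xs ys t s} → xs ≅ ys → All (_< t) xs → All (_< s) ys → xs ++ [ t ] ≅ ys ++ [ s ]
≅-++-max [] [] [] = [] ∷ []
≅-++-max (c ∷ p) (x<t ∷ xs<t) (y<s ∷ ys<s) =
  Pointwise.++⁺ c (SameComparison-< x<t y<s ∷ []) ∷ ≅-++-max p xs<t ys<s

≅-++⁻ : ∀ {τ} ys y → τ ≅ ys ++ [ y ] →
  ∃₂ λ τ₀ t → τ ≡ τ₀ ++ [ t ] × τ₀ ≅ ys × Pointwise (λ a b → SameComparison a b t y) τ₀ ys
≅-++⁻ [] y ([] ∷ []) = [] , _ , refl , [] , []
≅-++⁻ (_ ∷ ys) y (c ∷ p) with ≅-++⁻ ys y p
... | τ₀ , t , refl , q , last with Pointwise-++⁻ τ₀ ys (≅-length q) c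
... | c₀ , (ct ∷ []) = _ , t , refl , c₀ ∷ q , ct ∷ last

StrictlyMonotoneOn : (ℕ → Set) → (ℕ → ℕ) → Set
StrictlyMonotoneOn P f = ∀ {a b} → P a → P b → a < b → f a < f b

≅-map : (f : ℕ → ℕ) (P : ℕ → Set) → StrictlyMonotoneOn P f →
  ∀ {xs} → All P xs → map f xs ≅ xs
≅-map f P mono [] = []
≅-map f P mono (px ∷ pxs) = go px pxs ∷ ≅-map f P mono pxs
  where
  compare : ∀ {x x′} → P x → P x′ → SameComparison (f x) x (f x′) x′
  compare {x} {x′} px px′ with <-cmp x x′
  ... | tri< lt _ _ = SameComparison-< (mono px px′ lt) lt
  ... | tri≈ _ refl _ = SameComparison-self
  ... | tri> _ _ gt = SameComparison-> (mono px′ px gt) gt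
  go : ∀ {x ys} → P x → All P ys → Pointwise (SameComparison (f x) x) (map f ys) ys
  go px [] = []
  go px (py ∷ pys) = compare px py ∷ go px pys

Contains≅ : List ℕ → List ℕ → Set
Contains≅ σ π = ∃ λ τ → τ ⊆ σ × τ ≅ π

Contains⇔Contains≅ : ∀ {σ π} → Contains σ π ⇔ Contains≅ σ π
Contains⇔Contains≅ = mk⇔ (λ (τ , τ⊆σ , iso) → τ , τ⊆σ , OrderIso⇒≅ τ _ iso)
                          (λ (τ , τ⊆σ , iso) → τ , τ⊆σ , ≅⇒OrderIso iso)

ContainsCapped : List ℕ → List ℕ → Set
ContainsCapped σ r = ∃₂ λ τ t → τ ++ [ t ] ⊆ σ × τ ≅ r × All (_< t) τ

ContainsCapped-⊆ : ∀ {xs ys r} → xs ⊆ ys → ContainsCapped xs r → ContainsCapped ys r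
ContainsCapped-⊆ xs⊆ys (τ , t , sub , rest) = τ , t , ⊆-trans sub xs⊆ys , rest

Contains≅-++-max⇔ : ∀ {σ r s} → All (_< s) r → Contains≅ σ (r ++ [ s ]) ⇔ ContainsCapped σ r
Contains≅-++-max⇔ {r = r} {s} r<s = mk⇔ capped uncapped
  where
  below : ∀ {t τ₀ ys} → Pointwise (λ a b → SameComparison a b t s) τ₀ ys → All (_< s) ys → All (_< t) τ₀
  below [] [] = []
  below (c ∷ cs) (y<s ∷ ys<s) = from (proj₁ c) y<s ∷ below cs ys<s
  capped : ∀ {σ} → Contains≅ σ (r ++ [ s ]) → ContainsCapped σ r
  capped (τ , sub , iso) with ≅-++⁻ r s iso
  ... | τ₀ , t , refl , iso₀ , last = τ₀ , t , sub , iso₀ , below last r<s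
  uncapped : ∀ {σ} → ContainsCapped σ r → Contains≅ σ (r ++ [ s ])
  uncapped (τ₀ , t , sub , iso , τ₀<t) = _ , sub , ≅-++-max iso τ₀<t r<s

Contains1243∨2143 : List ℕ → Set
Contains1243∨2143 σ = ∃₂ λ a b → ∃₂ λ c d →
  a ∷ b ∷ c ∷ d ∷ [] ⊆ σ × a < d × b < d × d < c × a ≢ b

Contains1243∨2143-⊆ : ∀ {xs ys} → xs ⊆ ys → Contains1243∨2143 xs → Contains1243∨2143 ys
Contains1243∨2143-⊆ xs⊆ys (a , b , c , d , sub , rest) = a , b , c , d , ⊆-trans sub xs⊆ys , rest

private
  decide< : ∀ {m n} {m<n : True (m <? n)} → m < n
  decide< {m<n = m<n} = toWitness m<n

Contains≅-1243⇒ : ∀ {σ} → Contains≅ σ (1 ∷ 2 ∷ 4 ∷ 3 ∷ []) → Contains1243∨2143 σ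
Contains≅-1243⇒ (_ , sub , (c₁₂ ∷ _ ∷ c₁₃ ∷ []) ∷ (_ ∷ c₂₃ ∷ []) ∷ (c₄₃ ∷ []) ∷ _) =
  _ , _ , _ , _ , sub , from (proj₁ c₁₃) decide< , from (proj₁ c₂₃) decide< ,
  from (proj₂ c₄₃) decide< , <⇒≢ (from (proj₁ c₁₂) decide<)

Contains≅-2143⇒ : ∀ {σ} → Contains≅ σ (2 ∷ 1 ∷ 4 ∷ 3 ∷ []) → Contains1243∨2143 σ
Contains≅-2143⇒ (_ , sub , (c₂₁ ∷ _ ∷ c₂₃ ∷ []) ∷ (_ ∷ c₁₃ ∷ []) ∷ (c₄₃ ∷ []) ∷ _) =
  _ , _ , _ , _ , sub , from (proj₁ c₂₃) decide< , from (proj₁ c₁₃) decide< ,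
  from (proj₂ c₄₃) decide< , ≢-sym (<⇒≢ (from (proj₂ c₂₁) decide<))

private
  xy43-shape : ∀ {a b c d x y} → SameComparison a x b y → a < d → b < d → d < c → x < 3 → y < 3 →
    a ∷ b ∷ c ∷ d ∷ [] ≅ x ∷ y ∷ 4 ∷ 3 ∷ []
  xy43-shape ab a<d b<d d<c x<3 y<3 =
    (ab ∷ SameComparison-< (<-trans a<d d<c) (<-trans x<3 decide<) ∷ SameComparison-< a<d x<3 ∷ []) ∷
    (SameComparison-< (<-trans b<d d<c) (<-trans y<3 decide<) ∷ SameComparison-< b<d y<3 ∷ []) ∷
    (SameComparison-> d<c decide< ∷ []) ∷ [] ∷ []

Contains1243∨2143⇒ : ∀ {σ} → Contains1243∨2143 σ →
  Contains≅ σ (1 ∷ 2 ∷ 4 ∷ 3 ∷ []) ⊎ Contains≅ σ (2 ∷ 1 ∷ 4 ∷ 3 ∷ [])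
Contains1243∨2143⇒ (a , b , c , d , sub , a<d , b<d , d<c , a≢b) with <-cmp a b
... | tri< a<b _ _ = inj₁ (_ , sub , xy43-shape (SameComparison-< a<b decide<) a<d b<d d<c decide< decide<)
... | tri≈ _ a≡b _ = ⊥-elim (a≢b a≡b)
... | tri> _ _ b<a = inj₂ (_ , sub , xy43-shape (SameComparison-> b<a decide<) a<d b<d d<c decide< decide<)

Avoids-With1243-2143⇔ : ∀ {S σ} → Avoids (With1243-2143 S) σ ⇔ (¬ Contains1243∨2143 σ × Avoids S σ)
Avoids-With1243-2143⇔ = mk⇔
  (λ av → Sum.[ av _ (inj₁ refl) ∘ from Contains⇔Contains≅ , av _ (inj₂ (inj₁ refl)) ∘ from Contains⇔Contains≅ ]
            ∘ Contains1243∨2143⇒ ,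
          λ π Sπ → av π (inj₂ (inj₂ Sπ)))
  λ { (no4 , avS) π (inj₁ refl) → no4 ∘ Contains≅-1243⇒ ∘ to Contains⇔Contains≅
    ; (no4 , avS) π (inj₂ (inj₁ refl)) → no4 ∘ Contains≅-2143⇒ ∘ to Contains⇔Contains≅
    ; (no4 , avS) π (inj₂ (inj₂ Sπ)) → avS π Sπ }

-- Sublists and strictly monotone maps

⊆-++-last : ∀ (xs : List ℕ) {ys τ t} → τ ++ [ t ] ⊆ xs ++ ys → t ∉ ys → τ ++ [ t ] ⊆ xs
⊆-++-last [] {τ = τ} sub t∉ys = ⊥-elim (t∉ys (Sublist.Any-resp-⊆ sub (∈-++⁺ʳ τ (here refl))))
⊆-++-last (x ∷ xs) {τ = []} (_ ∷ʳ sub) t∉ys = x ∷ʳ ⊆-++-last xs {τ = []} sub t∉ys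
⊆-++-last (x ∷ xs) {τ = []} (refl ∷ _) _ = refl ∷ Sublist.[]⊆-universal xs
⊆-++-last (x ∷ xs) {τ = y ∷ τ} (_ ∷ʳ sub) t∉ys = x ∷ʳ ⊆-++-last xs {τ = y ∷ τ} sub t∉ys
⊆-++-last (x ∷ xs) {τ = _ ∷ τ} (refl ∷ sub) t∉ys = refl ∷ ⊆-++-last xs {τ = τ} sub t∉ys

⊆-++-init : ∀ {τ xs : List ℕ} {t y} → τ ++ [ t ] ⊆ xs ++ [ y ] → τ ⊆ xs
⊆-++-init {τ} {xs} {t} {y} sub =
  Sublist.reverse⁻ (Sublist.∷⁻ (subst₂ _⊆_ (reverse-++ τ [ t ]) (reverse-++ xs [ y ]) (Sublist.reverse⁺ sub)))

⊆-map⁻ : ∀ (f : ℕ → ℕ) xs {τ : List ℕ} → τ ⊆ map f xs → ∃ λ τ′ → τ′ ⊆ xs × τ ≡ map f τ′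
⊆-map⁻ f [] [] = [] , [] , refl
⊆-map⁻ f (x ∷ xs) (_ ∷ʳ sub) with τ′ , τ′⊆ , refl ← ⊆-map⁻ f xs sub = τ′ , x ∷ʳ τ′⊆ , refl
⊆-map⁻ f (x ∷ xs) (refl ∷ sub) with τ′ , τ′⊆ , refl ← ⊆-map⁻ f xs sub = x ∷ τ′ , refl ∷ τ′⊆ , refl

⊆-filter : ∀ {P : ℕ → Set} (P? : Decidable P) {τ σ} → All P τ → τ ⊆ σ → τ ⊆ filter P? σ
⊆-filter P? {τ} Pτ sub = subst (_⊆ _) (filter-all P? Pτ) (Sublist.filter⁺ P? P? (λ { refl Px → Px }) sub)

Unique-⊆ : ∀ {xs ys : List ℕ} → xs ⊆ ys → Unique ys → Unique xs
Unique-⊆ [] [] = []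
Unique-⊆ (_ ∷ʳ sub) (_ ∷ ys!) = Unique-⊆ sub ys!
Unique-⊆ (refl ∷ sub) (y∉ys ∷ ys!) = Sublist.All-resp-⊆ sub y∉ys ∷ Unique-⊆ sub ys!

module _ {P : ℕ → Set} {f : ℕ → ℕ} (mono : StrictlyMonotoneOn P f) where

  reflects-< : ∀ {a b} → P a → P b → f a < f b → a < b
  reflects-< {a} {b} Pa Pb fa<fb with <-cmp a b
  ... | tri< a<b _ _ = a<b
  ... | tri≈ _ refl _ = ⊥-elim (<-irrefl refl fa<fb)
  ... | tri> _ _ b<a = ⊥-elim (<-asym fa<fb (mono Pb Pa b<a))

  injective-on : ∀ {a b} → P a → P b → f a ≡ f b → a ≡ b
  injective-on {a} {b} Pa Pb fa≡fb with <-cmp a b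
  ... | tri< a<b _ _ = ⊥-elim (<-irrefl fa≡fb (mono Pa Pb a<b))
  ... | tri≈ _ a≡b _ = a≡b
  ... | tri> _ _ b<a = ⊥-elim (<-irrefl (sym fa≡fb) (mono Pb Pa b<a))

  Contains≅-map⁺ : ∀ {xs π} → All P xs → Contains≅ xs π → Contains≅ (map f xs) π
  Contains≅-map⁺ Pxs (τ , τ⊆ , iso) =
    map f τ , Sublist.map⁺ f τ⊆ , ≅-trans (≅-map f P mono (Sublist.All-resp-⊆ τ⊆ Pxs)) iso

  Contains≅-map⁻ : ∀ {xs π} → All P xs → Contains≅ (map f xs) π → Contains≅ xs π
  Contains≅-map⁻ {xs} Pxs (τ , τ⊆ , iso) with τ′ , τ′⊆ , refl ← ⊆-map⁻ f xs τ⊆ =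
    τ′ , τ′⊆ , ≅-trans (≅-sym (≅-map f P mono (Sublist.All-resp-⊆ τ′⊆ Pxs))) iso

  Contains1243∨2143-map⁺ : ∀ {xs} → All P xs → Contains1243∨2143 xs → Contains1243∨2143 (map f xs)
  Contains1243∨2143-map⁺ Pxs (a , b , c , d , sub , a<d , b<d , d<c , a≢b)
    with Pa ∷ Pb ∷ Pc ∷ Pd ∷ [] ← Sublist.All-resp-⊆ sub Pxs =
    f a , f b , f c , f d , Sublist.map⁺ f sub , mono Pa Pd a<d , mono Pb Pd b<d , mono Pd Pc d<c ,
    a≢b ∘ injective-on Pa Pb

  Contains1243∨2143-map⁻ : ∀ {xs} → All P xs → Contains1243∨2143 (map f xs) → Contains1243∨2143 xs
  Contains1243∨2143-map⁻ {xs} Pxs (_ , _ , _ , _ , sub , a<d , b<d , d<c , a≢b)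
    with a ∷ b ∷ c ∷ d ∷ [] , sub′ , refl ← ⊆-map⁻ f xs sub
    with Pa ∷ Pb ∷ Pc ∷ Pd ∷ [] ← Sublist.All-resp-⊆ sub′ Pxs =
    a , b , c , d , sub′ , reflects-< Pa Pd a<d , reflects-< Pb Pd b<d , reflects-< Pd Pc d<c , a≢b ∘ cong f

Contains1243∨2143-++-max : ∀ {xs M} → All (_< M) xs → Contains1243∨2143 (xs ++ [ M ]) → Contains1243∨2143 xs
Contains1243∨2143-++-max {xs} {M} xs<M (a , b , c , d , sub , a<d , b<d , d<c , a≢b) with d ≟ M
... | no d≢M =
  a , b , c , d , ⊆-++-last xs {τ = a ∷ b ∷ c ∷ []} sub (λ { (here d≡M) → d≢M d≡M }) , a<d , b<d , d<c , a≢b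
... | yes refl with _ ∷ _ ∷ c≤M ∷ _ ← Sublist.All-resp-⊆ sub (All.++⁺ (All.map <⇒≤ xs<M) (≤-refl ∷ [])) =
  ⊥-elim (<⇒≱ d<c c≤M)

-- Intervals and permutations

-- interval a l = a + 1, …, a + l; thus σ ↭ interval 0 n says σ ∈ 𝔖_n.
interval : ℕ → ℕ → List ℕ
interval a zero = []
interval a (suc l) = suc a ∷ interval (suc a) l

length-interval : ∀ a l → length (interval a l) ≡ l
length-interval a zero = refl
length-interval a (suc l) = cong suc (length-interval (suc a) l)

applyUpTo-interval : ∀ (f : ℕ → ℕ) a l → (∀ i → f i ≡ suc (a + i)) → applyUpTo f l ≡ interval a l
applyUpTo-interval f a zero _ = refl
applyUpTo-interval f a (suc l) f≗ =
  cong₂ _∷_ (trans (f≗ 0) (cong suc (+-identityʳ a)))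
    (applyUpTo-interval (f ∘ suc) (suc a) l (λ i → trans (f≗ (suc i)) (cong suc (+-suc a i))))

map-suc-upTo : ∀ n → map suc (upTo n) ≡ interval 0 n
map-suc-upTo n = trans (map-upTo suc n) (applyUpTo-interval suc 0 n (λ _ → refl))

interval-++ : ∀ a l₁ l₂ → interval a (l₁ + l₂) ≡ interval a l₁ ++ interval (a + l₁) l₂
interval-++ a zero l₂ = cong (λ b → interval b l₂) (sym (+-identityʳ a))
interval-++ a (suc l₁) l₂ =
  cong (suc a ∷_) (trans (interval-++ (suc a) l₁ l₂)
                         (cong (λ b → interval (suc a) l₁ ++ interval b l₂) (sym (+-suc a l₁))))

interval-suc : ∀ a l → interval a (suc l) ≡ interval a l ++ [ suc (a + l) ]
interval-suc a l = trans (cong (interval a) (+-comm 1 l)) (interval-++ a l 1)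

∷-interval-↭ : ∀ n → suc n ∷ interval 0 n ↭ interval 0 (suc n)
∷-interval-↭ n = ↭-trans (∷↭∷ʳ (suc n) (interval 0 n)) (↭-reflexive (sym (interval-suc 0 n)))

interval-split : ∀ m k → interval 0 m ++ interval m k ++ [ suc k + m ] ≡ interval 0 (suc k + m)
interval-split m k = begin
  interval 0 m ++ interval m k ++ [ suc k + m ]
    ≡⟨ cong (λ j → interval 0 m ++ interval m k ++ [ suc j ]) (+-comm k m) ⟩
  interval 0 m ++ interval m k ++ [ suc (m + k) ]   ≡⟨ cong (interval 0 m ++_) (interval-suc m k) ⟨
  interval 0 m ++ interval m (suc k)               ≡⟨ interval-++ 0 m (suc k) ⟨
  interval 0 (m + suc k)                           ≡⟨ cong (interval 0) (+-comm m (suc k)) ⟩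
  interval 0 (suc k + m)                           ∎
  where open ≡-Reasoning

∈-interval⁻ : ∀ {x} a l → x ∈ interval a l → a < x × x ≤ a + l
∈-interval⁻ a (suc l) (here refl) = ≤-refl , subst (suc a ≤_) (sym (+-suc a l)) (s≤s (m≤m+n a l))
∈-interval⁻ {x} a (suc l) (there x∈) with ∈-interval⁻ (suc a) l x∈
... | a<x , x≤ = <-trans (n<1+n a) a<x , subst (x ≤_) (sym (+-suc a l)) x≤

∈-interval⁺ : ∀ {x} a l → a < x → x ≤ a + l → x ∈ interval a l
∈-interval⁺ {x} a zero a<x x≤ = ⊥-elim (<-irrefl refl (<-≤-trans a<x (subst (x ≤_) (+-identityʳ a) x≤)))
∈-interval⁺ {x} a (suc l) a<x x≤ with x ≟ suc a
... | yes refl = here refl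
... | no x≢ = there (∈-interval⁺ (suc a) l (≤∧≢⇒< a<x (x≢ ∘ sym)) (subst (x ≤_) (+-suc a l) x≤))

interval-bounds : ∀ a l → All (λ x → a < x × x ≤ a + l) (interval a l)
interval-bounds a l = All.tabulate (∈-interval⁻ a l)

interval-unique : ∀ a l → Unique (interval a l)
interval-unique a zero = []
interval-unique a (suc l) =
  All.map (λ (a<x , _) → <⇒≢ a<x) (interval-bounds (suc a) l) ∷ interval-unique (suc a) l

filter-≤-interval : ∀ m k → filter (_≤? m) (interval 0 (suc k + m)) ≡ interval 0 m
filter-≤-interval m k = begin
  filter (_≤? m) (interval 0 (suc k + m))                   ≡⟨ cong (filter (_≤? m)) (interval-split m k) ⟨
  filter (_≤? m) (interval 0 m ++ interval m k ++ [ suc k + m ]) ≡⟨ filter-++ (_≤? m) (interval 0 m) _ ⟩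
  filter (_≤? m) (interval 0 m) ++ filter (_≤? m) (interval m k ++ [ suc k + m ])
    ≡⟨ cong₂ _++_ (filter-all (_≤? m) (All.map proj₂ (interval-bounds 0 m))) (filter-none (_≤? m) above) ⟩
  interval 0 m ++ []                                        ≡⟨ ++-identityʳ _ ⟩
  interval 0 m                                              ∎
  where
  open ≡-Reasoning
  above : All (λ x → ¬ x ≤ m) (interval m k ++ [ suc k + m ])
  above = All.++⁺ (All.map (<⇒≱ ∘ proj₁) (interval-bounds m k)) (<⇒≱ (m<n+m m (s≤s z≤n)) ∷ [])

module _ {σ : List ℕ} {n : ℕ} (σ↭ : σ ↭ interval 0 n) where

  ↭-interval-length : length σ ≡ n
  ↭-interval-length = trans (↭-length σ↭) (length-interval 0 n)

  ↭-interval-bounds : All (λ x → 0 < x × x ≤ n) σ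
  ↭-interval-bounds = All-resp-↭ (↭-sym σ↭) (interval-bounds 0 n)

  ↭-interval-self : σ ↭ interval 0 (length σ)
  ↭-interval-self = subst (λ k → σ ↭ interval 0 k) (sym ↭-interval-length) σ↭

  ↭-interval-unique : Unique σ
  ↭-interval-unique = Unique-resp-↭ (↭⇒↭ₛ (↭-sym σ↭)) (interval-unique 0 n)

  ↭-interval⇒IsPerm : IsPerm σ
  ↭-interval⇒IsPerm = subst (σ ↭_) (sym (trans (cong (map suc ∘ upTo) ↭-interval-length) (map-suc-upTo n))) σ↭

IsPerm⇒↭-interval : ∀ {σ} → IsPerm σ → σ ↭ interval 0 (length σ)
IsPerm⇒↭-interval {σ} = subst (σ ↭_) (map-suc-upTo (length σ))

Av⇔ : ∀ {S n σ} → Av (With1243-2143 S) n σ ⇔ (σ ↭ interval 0 n × ¬ Contains1243∨2143 σ × Avoids S σ)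
Av⇔ {S} {n} {σ} = mk⇔
  (λ { (perm , refl , av) → IsPerm⇒↭-interval perm , to Avoids-With1243-2143⇔ av })
  (λ (σ↭ , av) → ↭-interval⇒IsPerm σ↭ , ↭-interval-length σ↭ , from Avoids-With1243-2143⇔ av)

++-cancelˡ-↭ : ∀ (ws : List ℕ) {xs ys} → ws ++ xs ↭ ws ++ ys → xs ↭ ys
++-cancelˡ-↭ [] p = p
++-cancelˡ-↭ (w ∷ ws) p = ++-cancelˡ-↭ ws (drop-∷ p)

++-cancelʳ-↭ : ∀ {xs ys} (ws : List ℕ) → xs ++ ws ↭ ys ++ ws → xs ↭ ys
++-cancelʳ-↭ {xs} {ys} ws p = ++-cancelˡ-↭ ws (↭-trans (++-comm ws xs) (↭-trans p (++-comm ys ws)))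

++-∷-cancel-max : ∀ {x} (xs ys : List ℕ) {us vs} → All (_< x) xs → All (_< x) ys →
  xs ++ x ∷ us ≡ ys ++ x ∷ vs → xs ≡ ys × us ≡ vs
++-∷-cancel-max [] [] _ _ refl = refl , refl
++-∷-cancel-max [] (_ ∷ _) _ (y<x ∷ _) refl = ⊥-elim (<-irrefl refl y<x)
++-∷-cancel-max (_ ∷ _) [] (x<x ∷ _) _ refl = ⊥-elim (<-irrefl refl x<x)
++-∷-cancel-max (x ∷ xs) (y ∷ ys) (_ ∷ xs<) (_ ∷ ys<) eq with refl , eq′ ← ∷-injective eq
  with refl , refl ← ++-∷-cancel-max xs ys xs< ys< eq′ = refl , refl

-- Cardinalities

sum-map-const : ∀ {A : Set} c (xs : List A) → sum (map (λ _ → c) xs) ≡ length xs * c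
sum-map-const c [] = refl
sum-map-const c (_ ∷ xs) = cong (_+_ c) (sum-map-const c xs)

HasCard-unique : ∀ {P Q : List ℕ → Set} {a b} → HasCard P a → HasCard Q b → (∀ σ → P σ ⇔ Q σ) → a ≡ b
HasCard-unique (xs , refl , xs! , ∈xs⇔) (ys , refl , ys! , ∈ys⇔) P⇔Q =
  ↭-length (∼bag⇒↭ (unique∧set⇒bag xs! ys! λ {σ} → ⇔-trans (∈xs⇔ σ) (⇔-trans (P⇔Q σ) (⇔-sym (∈ys⇔ σ)))))

HasCard-resp : ∀ {P Q : List ℕ → Set} {a} → (∀ σ → P σ ⇔ Q σ) → HasCard P a → HasCard Q a
HasCard-resp P⇔Q (xs , len , xs! , ∈xs⇔) = xs , len , xs! , λ σ → ⇔-trans (∈xs⇔ σ) (P⇔Q σ)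

HasCard-⊎ : ∀ {P Q : List ℕ → Set} {a b} → HasCard P a → HasCard Q b → (∀ {σ} → P σ → Q σ → ⊥) →
  HasCard (λ σ → P σ ⊎ Q σ) (a + b)
HasCard-⊎ (xs , refl , xs! , ∈xs⇔) (ys , refl , ys! , ∈ys⇔) disjoint =
  xs ++ ys , length-++ xs , ++⁺ xs! ys! (λ (σ∈xs , σ∈ys) → disjoint (to (∈xs⇔ _) σ∈xs) (to (∈ys⇔ _) σ∈ys)) ,
  λ σ → mk⇔ (Sum.map (to (∈xs⇔ σ)) (to (∈ys⇔ σ)) ∘ ∈-++⁻ xs)
            Sum.[ ∈-++⁺ˡ ∘ from (∈xs⇔ σ) , ∈-++⁺ʳ xs ∘ from (∈ys⇔ σ) ]

HasCard-⋃ : ∀ {I : Set} {F : I → List ℕ → Set} {c : I → ℕ} (is : List I) → Unique is →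
  (∀ {i} → i ∈ is → HasCard (F i) (c i)) →
  (∀ {i j σ} → i ∈ is → j ∈ is → F i σ → F j σ → i ≡ j) →
  HasCard (λ σ → ∃ λ i → i ∈ is × F i σ) (sum (map c is))
HasCard-⋃ [] _ _ _ = [] , refl , [] , λ σ → mk⇔ (λ ()) (λ ())
HasCard-⋃ {F = F} (i ∷ is) (i∉is ∷ is!) card disjoint =
  HasCard-resp cases
    (HasCard-⊎ (card (here refl)) (HasCard-⋃ is is! (card ∘ there) (λ i∈ j∈ → disjoint (there i∈) (there j∈)))
      λ { Fiσ (j , j∈is , Fjσ) → All.lookup i∉is j∈is (disjoint (here refl) (there j∈is) Fiσ Fjσ) })
  where
  cases : ∀ σ → (F i σ ⊎ ∃ λ j → j ∈ is × F j σ) ⇔ (∃ λ j → j ∈ i ∷ is × F j σ)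
  cases σ = mk⇔ Sum.[ (λ Fiσ → i , here refl , Fiσ) , (λ (j , j∈ , Fjσ) → j , there j∈ , Fjσ) ]
                 λ { (j , here refl , Fjσ) → inj₁ Fjσ ; (j , there j∈ , Fjσ) → inj₂ (j , j∈ , Fjσ) }

HasCard-image : ∀ {P : List ℕ → Set} {a} (f : List ℕ → List ℕ) → HasCard P a →
  (∀ {σ τ} → P σ → P τ → f σ ≡ f τ → σ ≡ τ) → HasCard (λ σ → ∃ λ τ → P τ × f τ ≡ σ) a
HasCard-image {P} f (xs , refl , xs! , ∈xs⇔) injective =
  map f xs , length-map f xs , map-unique xs! (All.tabulate (to (∈xs⇔ _))) ,
  λ σ → mk⇔ (λ σ∈ → let τ , τ∈ , eq = ∈-map⁻ f σ∈ in τ , to (∈xs⇔ τ) τ∈ , sym eq)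
            (λ { (τ , Pτ , refl) → ∈-map⁺ f (from (∈xs⇔ τ) Pτ) })
  where
  map-unique : ∀ {ys} → Unique ys → All P ys → Unique (map f ys)
  map-unique [] [] = []
  map-unique (y∉ys ∷ ys!) (Py ∷ Pys) =
    All.map⁺ (All.zipWith (λ (y≢z , Pz) fy≡fz → y≢z (injective Py Pz fy≡fz)) (y∉ys , Pys)) ∷ map-unique ys! Pys

-- Joining two permutations

-- lift c m sends 1 to c and every v ≥ 2 to v + m - 1 (so above 1, …, m); its value at 0 is junk.
lift : ℕ → ℕ → ℕ → ℕ
lift c m zero = c
lift c m (suc zero) = c
lift c m (suc (suc j)) = suc (m + j)

lower : ℕ → ℕ → ℕ
lower m v = suc (v ∸ m)

lift-≤ : ∀ c m v → lift c m v ≤ m → lift c m v ≡ c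
lift-≤ c m zero _ = refl
lift-≤ c m (suc zero) _ = refl
lift-≤ c m (suc (suc j)) le = ⊥-elim (<-irrefl refl (<-≤-trans (s≤s (m≤m+n m j)) le))

lift-mono : ∀ {c m} → c ≤ m → StrictlyMonotoneOn (0 <_) (lift c m)
lift-mono c≤m {suc zero} {suc (suc j)} _ _ _ = s≤s (≤-trans c≤m (m≤m+n _ j))
lift-mono c≤m {suc (suc i)} {suc (suc j)} _ _ (s≤s (s≤s i<j)) = s≤s (+-monoʳ-< _ i<j)
lift-mono c≤m {suc zero} {suc zero} _ _ (s≤s ())

lift-< : ∀ {c m k} → c ≤ m → ∀ v → 0 < v → v ≤ suc k → lift c m v < suc k + m
lift-< {k = k} c≤m (suc zero) _ _ = s≤s (≤-trans c≤m (m≤n+m _ k))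
lift-< {m = m} {k} c≤m (suc (suc j)) _ (s≤s j<k) =
  s≤s (subst (_≤ k + m) (cong suc (+-comm j m)) (+-monoˡ-≤ m j<k))

lift-suc : ∀ c m {k} → 0 < k → lift c m (suc k) ≡ k + m
lift-suc c m {suc k} _ = cong suc (+-comm m k)

lower-lift : ∀ {c m} → c ≤ m → ∀ v → 0 < v → lower m (lift c m v) ≡ v
lower-lift c≤m (suc zero) _ = cong suc (m≤n⇒m∸n≡0 c≤m)
lower-lift {m = m} c≤m (suc (suc j)) _ = cong suc (trans (cong (_∸ m) (sym (+-suc m j))) (m+n∸m≡n m (suc j)))

lift-lower : ∀ c m v → (v ≤ m → v ≡ c) → lift c m (lower m v) ≡ v
lift-lower c m v small with v ≤? m
... | yes v≤m = trans (cong (λ d → lift c m (suc d)) (m≤n⇒m∸n≡0 v≤m)) (sym (small v≤m))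
... | no v≰m = shifted (v ∸ m) (m+[n∸m]≡n (<⇒≤ (≰⇒> v≰m))) (m<n⇒0<n∸m (≰⇒> v≰m))
  where
  shifted : ∀ d → m + d ≡ v → 0 < d → lift c m (suc d) ≡ v
  shifted (suc j) m+d≡v _ = trans (sym (+-suc m j)) m+d≡v

map-lift-interval : ∀ c m i l → map (lift c m) (interval (suc i) l) ≡ interval (m + i) l
map-lift-interval c m i zero = refl
map-lift-interval c m i (suc l) =
  cong (_ ∷_) (trans (map-lift-interval c m (suc i) l) (cong (λ a → interval a l) (+-suc m i)))

map-lower-interval : ∀ m i l → map (lower m) (interval (m + i) l) ≡ interval (suc i) l
map-lower-interval m i zero = refl
map-lower-interval m i (suc l) =
  cong₂ _∷_ (cong suc (trans (cong (_∸ m) (sym (+-suc m i))) (m+n∸m≡n m (suc i))))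
    (trans (cong (λ a → map (lower m) (interval a l)) (sym (+-suc m i))) (map-lower-interval m (suc i) l))

-- For α ∈ 𝔖_k and γ = c ∷ β ∈ 𝔖_m the entries ≤ m of join α γ read γ, while c and the entries
-- above m read a copy of α followed by its maximum.
join : List ℕ → List ℕ → List ℕ
join α [] = []
join α (c ∷ β) = map (lift c (suc (length β))) α ++ length α + suc (length β) ∷ β

module Join {α β : List ℕ} {c : ℕ}
  (α↭ : α ↭ interval 0 (length α)) (γ↭ : c ∷ β ↭ interval 0 (suc (length β))) (k>0 : 0 < length α) where

  k m n : ℕ
  k = length α
  m = suc (length β)
  n = k + m

  f : ℕ → ℕ
  f = lift c m

  high : List ℕ
  high = map f (α ++ [ suc k ])

  c≤m : c ≤ m
  c≤m with (_ , c≤m) ∷ _ ← ↭-interval-bounds γ↭ = c≤m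

  β≤m : All (_≤ m) β
  β≤m with _ ∷ bounds ← ↭-interval-bounds γ↭ = All.map proj₂ bounds

  α-bounds : All (λ v → 0 < v × v ≤ k) α
  α-bounds = ↭-interval-bounds α↭

  high-positive : All (0 <_) (α ++ [ suc k ])
  high-positive = All.++⁺ (All.map proj₁ α-bounds) (s≤s z≤n ∷ [])

  join≡high++β : join α (c ∷ β) ≡ high ++ β
  join≡high++β = begin
    map f α ++ n ∷ β               ≡⟨ cong (λ x → map f α ++ x ∷ β) (lift-suc c m k>0) ⟨
    map f α ++ [ f (suc k) ] ++ β   ≡⟨ ++-assoc (map f α) _ β ⟨
    (map f α ++ [ f (suc k) ]) ++ β ≡⟨ cong (_++ β) (map-++ f α [ suc k ]) ⟨
    high ++ β                       ∎
    where open ≡-Reasoning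

  high-small : All (λ w → w ≤ m → w ≡ c) high
  high-small = All.map⁺ (All.universal (lift-≤ c m) _)

  k′ : ℕ
  k′ = pred k

  k≡1+k′ : k ≡ suc k′
  k≡1+k′ = sym (suc-pred k {{>-nonZero k>0}})

  m<n : m < n
  m<n = m<n+m m k>0

  1+k′+m≡n : suc k′ + m ≡ n
  1+k′+m≡n = cong (_+ m) (sym k≡1+k′)

  map-α↭ : map f α ↭ c ∷ interval m k′
  map-α↭ = begin
    map f α                     ↭⟨ map⁺ f α↭ ⟩
    map f (interval 0 k)        ≡⟨ cong (map f ∘ interval 0) k≡1+k′ ⟩
    c ∷ map f (interval 1 k′)   ≡⟨ cong (c ∷_) (map-lift-interval c m 0 k′) ⟩
    c ∷ interval (m + 0) k′     ≡⟨ cong (λ a → c ∷ interval a k′) (+-identityʳ m) ⟩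
    c ∷ interval m k′           ∎
    where open PermutationReasoning

  join-↭ : join α (c ∷ β) ↭ interval 0 n
  join-↭ = begin
    map f α ++ n ∷ β                     ↭⟨ ++⁺ʳ (n ∷ β) map-α↭ ⟩
    c ∷ (interval m k′ ++ n ∷ β)         ↭⟨ ↭-prep c (++⁺ˡ (interval m k′) (∷↭∷ʳ n β)) ⟩
    c ∷ (interval m k′ ++ β ++ [ n ])    ↭⟨ ↭-prep c (shifts (interval m k′) β) ⟩
    (c ∷ β) ++ interval m k′ ++ [ n ]    ↭⟨ ++⁺ʳ (interval m k′ ++ [ n ]) γ↭ ⟩
    interval 0 m ++ interval m k′ ++ [ n ] ≡⟨ cong (λ j → interval 0 m ++ interval m k′ ++ [ j ]) 1+k′+m≡n ⟨
    interval 0 m ++ interval m k′ ++ [ suc k′ + m ] ≡⟨ interval-split m k′ ⟩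
    interval 0 (suc k′ + m)              ≡⟨ cong (interval 0) 1+k′+m≡n ⟩
    interval 0 n                         ∎
    where open PermutationReasoning

  lifted<n : All (_< n) (map f α)
  lifted<n = All.map⁺ (All.map bound α-bounds)
    where
    bound : ∀ {v} → 0 < v × v ≤ k → f v < n
    bound {v} (v>0 , v≤k) = subst (f v <_) 1+k′+m≡n (lift-< c≤m v v>0 (subst (v ≤_) k≡1+k′ v≤k))

  lower-lifted : map (lower m) (map f α) ≡ α
  lower-lifted = trans (sym (map-∘ α)) (map-id-local (All.map (lower-lift c≤m _ ∘ proj₁) α-bounds))

  join-low : filter (_≤? m) (join α (c ∷ β)) ≡ c ∷ β
  join-low = begin
    filter (_≤? m) (map f α ++ n ∷ β)                 ≡⟨ filter-++ (_≤? m) (map f α) (n ∷ β) ⟩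
    filter (_≤? m) (map f α) ++ filter (_≤? m) (n ∷ β) ≡⟨ cong (_++ filter (_≤? m) (n ∷ β)) low-α ⟩
    c ∷ filter (_≤? m) (n ∷ β)                       ≡⟨ cong (c ∷_) (filter-reject (_≤? m) (<⇒≱ m<n)) ⟩
    c ∷ filter (_≤? m) β                             ≡⟨ cong (c ∷_) (filter-all (_≤? m) β≤m) ⟩
    c ∷ β                                            ∎
    where
    open ≡-Reasoning
    low-α : filter (_≤? m) (map f α) ≡ [ c ]
    low-α = ↭-singleton-inv (↭-trans (filter-↭ (_≤? m) map-α↭) (↭-reflexive
      (trans (filter-accept (_≤? m) c≤m)
        (cong (c ∷_) (filter-none (_≤? m) (All.map (λ (m<x , _) → <⇒≱ m<x) (interval-bounds m k′)))))))

join-injective : ∀ {α c β α′ c′ β′} →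
  (α↭ : α ↭ interval 0 (length α)) (γ↭ : c ∷ β ↭ interval 0 (suc (length β))) (k>0 : 0 < length α) →
  (α′↭ : α′ ↭ interval 0 (length α′)) (γ′↭ : c′ ∷ β′ ↭ interval 0 (suc (length β′))) (k′>0 : 0 < length α′) →
  join α (c ∷ β) ≡ join α′ (c′ ∷ β′) → α ≡ α′ × c ∷ β ≡ c′ ∷ β′
join-injective {α} {c} {β} {α′} {c′} {β′} α↭ γ↭ k>0 α′↭ γ′↭ k′>0 eq = α≡α′ , γ≡γ′
  where
  module J = Join α↭ γ↭ k>0
  module J′ = Join α′↭ γ′↭ k′>0
  n≡n′ : J.n ≡ J′.n
  n≡n′ = trans (sym (↭-interval-length J.join-↭)) (trans (cong length eq) (↭-interval-length J′.join-↭))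
  split : map J.f α ≡ map J′.f α′ × β ≡ β′
  split = ++-∷-cancel-max (map J.f α) (map J′.f α′)
    J.lifted<n (subst (λ x → All (_< x) (map J′.f α′)) (sym n≡n′) J′.lifted<n)
    (trans eq (cong (λ x → map J′.f α′ ++ x ∷ β′) (sym n≡n′)))
  m≡m′ : J.m ≡ J′.m
  m≡m′ = cong (suc ∘ length) (proj₂ split)
  α≡α′ : α ≡ α′
  α≡α′ = trans (sym J.lower-lifted) (trans (cong₂ (λ m xs → map (lower m) xs) m≡m′ (proj₁ split)) J′.lower-lifted)
  γ≡γ′ : c ∷ β ≡ c′ ∷ β′
  γ≡γ′ = trans (sym J.join-low) (trans (cong₂ (λ m σ → filter (_≤? m) σ) m≡m′ eq) J′.join-low)

join-head : ∀ {α c β τ} →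
  (α↭ : α ↭ interval 0 (length α)) (γ↭ : c ∷ β ↭ interval 0 (suc (length β))) (k>0 : 0 < length α) →
  join α (c ∷ β) ≢ length α + suc (length β) ∷ τ
join-head {a ∷ _} α↭ γ↭ k>0 eq with a<n ∷ _ ← Join.lifted<n α↭ γ↭ k>0 = <-irrefl (proj₁ (∷-injective eq)) a<n

module Decompose {n : ℕ} {α β : List ℕ} (σ↭ : α ++ suc n ∷ β ↭ interval 0 (suc n))
  (no4 : ¬ Contains1243∨2143 (α ++ suc n ∷ β)) (k>0 : 0 < length α) where

  N k m k′ : ℕ
  N = suc n
  k = length α
  m = suc (length β)
  k′ = pred k

  σ : List ℕ
  σ = α ++ N ∷ β

  F : List ℕ → List ℕ
  F = filter (_≤? m)

  k≡1+k′ : k ≡ suc k′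
  k≡1+k′ = sym (suc-pred k {{>-nonZero k>0}})

  k+m≡N : k + m ≡ N
  k+m≡N = trans (sym (length-++ α)) (↭-interval-length σ↭)

  1+k′+m≡N : suc k′ + m ≡ N
  1+k′+m≡N = trans (cong (_+ m) (sym k≡1+k′)) k+m≡N

  m<N : m < N
  m<N = subst (m <_) 1+k′+m≡N (m<n+m m (s≤s z≤n))

  α++β↭ : α ++ β ↭ interval 0 n
  α++β↭ = drop-∷ (↭-trans (↭-sym (shift N α β)) (↭-trans σ↭ (↭-sym (∷-interval-↭ n))))

  α<N : All (_< N) α
  α<N = All.map (s≤s ∘ proj₂) (All.++⁻ˡ α (↭-interval-bounds α++β↭))

  F-σ : F σ ≡ F α ++ F β
  F-σ = trans (filter-++ (_≤? m) α (N ∷ β)) (cong (F α ++_) (filter-reject (_≤? m) (<⇒≱ m<N)))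

  F-σ↭ : F σ ↭ interval 0 m
  F-σ↭ = ↭-trans (filter-↭ (_≤? m) σ↭)
    (↭-reflexive (trans (cong (F ∘ interval 0) (sym 1+k′+m≡N)) (filter-≤-interval m k′)))

  length-F : length (F α) + length (F β) ≡ m
  length-F = begin
    length (F α) + length (F β)   ≡⟨ length-++ (F α) ⟨
    length (F α ++ F β)           ≡⟨ cong length F-σ ⟨
    length (F σ)                  ≡⟨ ↭-interval-length F-σ↭ ⟩
    m                             ∎
    where open ≡-Reasoning

  β<N : All (_< N) β
  β<N = All.map (s≤s ∘ proj₂) (All.++⁻ʳ α (↭-interval-bounds α++β↭))

  large-in-β⇒2≤|Fα| : Any (λ z → ¬ z ≤ m) β → 2 ≤ length (F α)
  large-in-β⇒2≤|Fα| z-large = +-cancelʳ-≤ (length (F β)) 2 (length (F α))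
    (subst (2 + length (F β) ≤_) (sym length-F) (s≤s (filter-notAll (_≤? m) β z-large)))

  no-large-in-β : Any (λ z → ¬ z ≤ m) β → ⊥
  no-large-in-β z-large
    with z , z∈β , z≰m ← find z-large
    with F α | All.all-filter (_≤? m) α | Sublist.filter-⊆ (_≤? m) α | large-in-β⇒2≤|Fα| z-large
  ... | _ ∷ [] | _ | _ | s≤s ()
  ... | x₁ ∷ x₂ ∷ rest | x₁≤m ∷ x₂≤m ∷ _ | Fα⊆α | _
    with pair⊆α ← ⊆-trans (Sublist.++⁺ʳ rest ⊆-refl) Fα⊆α
    with (x₁≢x₂ ∷ _) ∷ _ ← Unique-⊆ (⊆-trans pair⊆α (Sublist.++⁺ʳ (N ∷ β) ⊆-refl)) (↭-interval-unique σ↭) =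
    no4 (x₁ , x₂ , N , z , Sublist.++⁺ pair⊆α (refl ∷ from∈ z∈β) ,
         ≤-<-trans x₁≤m (≰⇒> z≰m) , ≤-<-trans x₂≤m (≰⇒> z≰m) , All.lookup β<N z∈β , x₁≢x₂)

  β≤m : All (_≤ m) β
  β≤m with all? (_≤? m) β
  ... | yes β≤m = β≤m
  ... | no β≰m = ⊥-elim (no-large-in-β (All.¬All⇒Any¬ (_≤? m) β β≰m))

  |Fα|≡1 : length (F α) ≡ 1
  |Fα|≡1 = +-cancelʳ-≡ (length β) (length (F α)) 1
    (trans (cong (λ xs → length (F α) + length xs) (sym (filter-all (_≤? m) β≤m))) length-F)

  F-α-singleton : ∃ λ c → F α ≡ [ c ]
  F-α-singleton with F α | |Fα|≡1
  ... | c ∷ [] | _ = c , refl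

  c : ℕ
  c = proj₁ F-α-singleton

  F-α : F α ≡ [ c ]
  F-α = proj₂ F-α-singleton

  c∈α×c≤m : c ∈ α × c ≤ m
  c∈α×c≤m = ∈-filter⁻ (_≤? m) (subst (c ∈_) (sym F-α) (here refl))

  small-α : ∀ {v} → v ∈ α → v ≤ m → v ≡ c
  small-α v∈α v≤m with here v≡c ← subst (_ ∈_) F-α (∈-filter⁺ (_≤? m) v∈α v≤m) = v≡c

  γ↭ : c ∷ β ↭ interval 0 m
  γ↭ = subst (_↭ _) (trans F-σ (cong₂ _++_ F-α (filter-all (_≤? m) β≤m))) F-σ↭

  γ⊆σ : c ∷ β ⊆ σ
  γ⊆σ = Sublist.++⁺ (from∈ (proj₁ c∈α×c≤m)) (N ∷ʳ ⊆-refl)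

  α↭ : α ↭ c ∷ interval m k′
  α↭ = ++-cancelʳ-↭ (N ∷ β) (begin
    α ++ N ∷ β                                    ↭⟨ σ↭ ⟩
    interval 0 N                                  ≡⟨ cong (interval 0) 1+k′+m≡N ⟨
    interval 0 (suc k′ + m)                       ≡⟨ interval-split m k′ ⟨
    interval 0 m ++ interval m k′ ++ [ suc k′ + m ] ≡⟨ cong (λ j → interval 0 m ++ interval m k′ ++ [ j ]) 1+k′+m≡N ⟩
    interval 0 m ++ interval m k′ ++ [ N ]        ↭⟨ ++⁺ʳ (interval m k′ ++ [ N ]) γ↭ ⟨
    c ∷ β ++ interval m k′ ++ [ N ]               ↭⟨ ↭-prep c (++-comm β (interval m k′ ++ [ N ])) ⟩
    c ∷ (interval m k′ ++ [ N ]) ++ β             ≡⟨ cong (c ∷_) (++-assoc (interval m k′) [ N ] β) ⟩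
    c ∷ interval m k′ ++ N ∷ β                    ∎)
    where open PermutationReasoning

  α₀ : List ℕ
  α₀ = map (lower m) α

  α₀↭ : α₀ ↭ interval 0 k
  α₀↭ = begin
    map (lower m) α                             ↭⟨ map⁺ (lower m) α↭ ⟩
    lower m c ∷ map (lower m) (interval m k′)   ≡⟨ cong (λ a → lower m c ∷ map (lower m) (interval a k′)) (+-identityʳ m) ⟨
    lower m c ∷ map (lower m) (interval (m + 0) k′)
      ≡⟨ cong₂ _∷_ (cong suc (m≤n⇒m∸n≡0 (proj₂ c∈α×c≤m))) (map-lower-interval m 0 k′) ⟩
    interval 0 (suc k′)                         ≡⟨ cong (interval 0) k≡1+k′ ⟨
    interval 0 k                                ∎
    where open PermutationReasoning

  α₀-positive : All (0 <_) α₀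
  α₀-positive = All.map⁺ (All.universal (λ _ → s≤s z≤n) α)

  lift-α₀ : map (lift c m) α₀ ≡ α
  lift-α₀ = trans (sym (map-∘ α)) (map-id-local (All.tabulate λ v∈α → lift-lower c m _ (small-α v∈α)))

  σ≡join : σ ≡ join α₀ (c ∷ β)
  σ≡join = sym (cong₂ (λ xs j → xs ++ j ∷ β) lift-α₀ (trans (cong (_+ m) (length-map (lower m) α)) k+m≡N))

-- The recurrence

joinCount : (ℕ → ℕ) → (ℕ → ℕ) → ℕ → ℕ
joinCount p q n = sum (map (λ j → q j * p (suc n ∸ j)) (interval 0 n))

module _ (R : List ℕ → Set) (R-perm : ∀ r → R r → IsPerm r × 1 ≤ length r) where

  AvoidsR : List ℕ → Set
  AvoidsR σ = ¬ Contains1243∨2143 σ × (∀ r → R r → ¬ Contains≅ σ r)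

  AvoidsRn : List ℕ → Set
  AvoidsRn σ = ¬ Contains1243∨2143 σ × (∀ r → R r → ¬ ContainsCapped σ r)

  Av-R : ℕ → List ℕ → Set
  Av-R n σ = σ ↭ interval 0 n × AvoidsR σ

  Av-Rn : ℕ → List ℕ → Set
  Av-Rn n σ = σ ↭ interval 0 n × AvoidsRn σ

  R-bounded : ∀ {r} → R r → All (_< suc (length r)) r
  R-bounded {r} Rr = All.map (s≤s ∘ proj₂) (↭-interval-bounds (IsPerm⇒↭-interval (proj₁ (R-perm r Rr))))

  R-nonempty : ∀ {r} → R r → ¬ [] ≅ r
  R-nonempty {r} Rr [] with () ← proj₂ (R-perm r Rr)

  Av⇔Av-R : ∀ {n σ} → Av (With1243-2143 R) n σ ⇔ Av-R n σ
  Av⇔Av-R = ⇔-trans Av⇔ (mk⇔ (λ (σ↭ , no4 , av) → σ↭ , no4 , λ r Rr → av r Rr ∘ from Contains⇔Contains≅)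
                             (λ (σ↭ , no4 , av) → σ↭ , no4 , λ r Rr → av r Rr ∘ to Contains⇔Contains≅))

  Av⇔Av-Rn : ∀ {n σ} → Av (With1243-2143 (AppendMax R)) n σ ⇔ Av-Rn n σ
  Av⇔Av-Rn = ⇔-trans Av⇔ (mk⇔
    (λ (σ↭ , no4 , av) → σ↭ , no4 , λ r Rr →
       av _ (r , Rr , refl) ∘ from Contains⇔Contains≅ ∘ from (Contains≅-++-max⇔ (R-bounded Rr)))
    (λ { (σ↭ , no4 , av) → σ↭ , no4 , λ { _ (r , Rr , refl) →
       av r Rr ∘ to (Contains≅-++-max⇔ (R-bounded Rr)) ∘ to Contains⇔Contains≅ } }))

  Av-R-zero : ∀ {σ} → Av-R 0 σ ⇔ σ ≡ []
  Av-R-zero = mk⇔ (↭-empty-inv ∘ proj₁)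
    λ { refl → ↭-refl , (λ { (_ , _ , _ , _ , () , _) }) , λ { r Rr (_ , [] , iso) → R-nonempty Rr iso } }

  Av-Rn-zero : ∀ {σ} → Av-Rn 0 σ ⇔ σ ≡ []
  Av-Rn-zero = mk⇔ (↭-empty-inv ∘ proj₁)
    λ { refl → ↭-refl , (λ { (_ , _ , _ , _ , () , _) }) , λ { r Rr ([] , _ , () , _) ; r Rr (_ ∷ _ , _ , () , _) } }

  Av-Rn-cons-max : ∀ {n τ} → Av-Rn n τ → Av-Rn (suc n) (suc n ∷ τ)
  Av-Rn-cons-max {n} {τ} (τ↭ , no4 , noCapped) = σ↭ , no4′ , noCapped′
    where
    τ≤n : All (_≤ n) τ
    τ≤n = All.map proj₂ (↭-interval-bounds τ↭)
    σ↭ : suc n ∷ τ ↭ interval 0 (suc n)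
    σ↭ = ↭-trans (↭-prep (suc n) τ↭) (∷-interval-↭ n)
    no4′ : ¬ Contains1243∨2143 (suc n ∷ τ)
    no4′ (a , b , c , d , _ ∷ʳ sub , rest) = no4 (a , b , c , d , sub , rest)
    no4′ (_ , _ , _ , _ , refl ∷ sub , a<d , _) with _ ∷ _ ∷ d≤n ∷ [] ← Sublist.All-resp-⊆ sub τ≤n =
      <⇒≱ a<d (m≤n⇒m≤1+n d≤n)
    noCapped′ : ∀ r → R r → ¬ ContainsCapped (suc n ∷ τ) r
    noCapped′ r Rr ([] , t , _ ∷ʳ sub , rest) = noCapped r Rr ([] , t , sub , rest)
    noCapped′ r Rr ([] , t , refl ∷ _ , iso , _) = R-nonempty Rr iso
    noCapped′ r Rr (x ∷ τ₀ , t , _ ∷ʳ sub , rest) = noCapped r Rr (x ∷ τ₀ , t , sub , rest)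
    noCapped′ r Rr (_ ∷ τ₀ , t , refl ∷ sub , _ , n<t ∷ _) =
      <⇒≱ n<t (m≤n⇒m≤1+n (All.lookup τ≤n (Sublist.Any-resp-⊆ sub (∈-++⁺ʳ τ₀ (here refl)))))

  Av-Rn-cons-max⁻ : ∀ {n τ} → Av-Rn (suc n) (suc n ∷ τ) → Av-Rn n τ
  Av-Rn-cons-max⁻ {n} {τ} (σ↭ , no4 , noCapped) =
    τ↭ , no4 ∘ Contains1243∨2143-⊆ (suc n ∷ʳ ⊆-refl) , λ r Rr → noCapped r Rr ∘ ContainsCapped-⊆ (suc n ∷ʳ ⊆-refl)
    where
    τ↭ : τ ↭ interval 0 n
    τ↭ = drop-∷ (↭-trans σ↭ (↭-sym (∷-interval-↭ n)))

  -- An occurrence ending in an entry ≤ m consists of entries ≤ m and so lies in γ; one ending above m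
  -- lies in the copy of α (k+1).
  join-avoids : ∀ {α c β} (α↭ : α ↭ interval 0 (length α)) (γ↭ : c ∷ β ↭ interval 0 (suc (length β))) →
    0 < length α → AvoidsR α → AvoidsRn (c ∷ β) → AvoidsRn (join α (c ∷ β))
  join-avoids {α} {c} {β} α↭ γ↭ k>0 (α-no4 , α-noR) (γ-no4 , γ-noCapped) = no4 , noCapped
    where
    open Join α↭ γ↭ k>0
    σ : List ℕ
    σ = join α (c ∷ β)
    mono : StrictlyMonotoneOn (0 <_) f
    mono = lift-mono c≤m
    low : ∀ {τ} → τ ⊆ σ → All (_≤ m) τ → τ ⊆ c ∷ β
    low sub τ≤m = subst (_ ⊆_) join-low (⊆-filter (_≤? m) τ≤m sub)
    in-high : ∀ τ {t} → τ ++ [ t ] ⊆ σ → m < t → τ ++ [ t ] ⊆ high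
    in-high τ sub m<t = ⊆-++-last high {τ = τ} (subst (_ ⊆_) join≡high++β sub) (<⇒≱ m<t ∘ All.lookup β≤m)
    no4 : ¬ Contains1243∨2143 σ
    no4 (a , b , c′ , d , sub , a<d , b<d , d<c′ , a≢b) with d ≤? m | c′ ≤? m
    ... | no d≰m | _ =
      α-no4 (Contains1243∨2143-++-max (All.map (s≤s ∘ proj₂) α-bounds) (Contains1243∨2143-map⁻ mono high-positive
        (a , b , c′ , d , in-high (a ∷ b ∷ c′ ∷ []) sub (≰⇒> d≰m) , a<d , b<d , d<c′ , a≢b)))
    ... | yes d≤m | yes c′≤m =
      γ-no4 (a , b , c′ , d , low sub (<⇒≤ (<-≤-trans a<d d≤m) ∷ <⇒≤ (<-≤-trans b<d d≤m) ∷ c′≤m ∷ d≤m ∷ []) ,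
             a<d , b<d , d<c′ , a≢b)
    ... | yes d≤m | no c′≰m
      with ab⊆high ← in-high (a ∷ b ∷ []) (⊆-trans (Sublist.++⁺ʳ [ d ] ⊆-refl) sub) (≰⇒> c′≰m)
      with a-small ∷ b-small ∷ _ ← Sublist.All-resp-⊆ ab⊆high high-small
      = a≢b (trans (a-small (<⇒≤ (<-≤-trans a<d d≤m))) (sym (b-small (<⇒≤ (<-≤-trans b<d d≤m)))))
    noCapped : ∀ r → R r → ¬ ContainsCapped σ r
    noCapped r Rr (τ , t , sub , iso , τ<t) with t ≤? m
    ... | yes t≤m =
      γ-noCapped r Rr (τ , t , low sub (All.++⁺ (All.map (λ x<t → <⇒≤ (<-≤-trans x<t t≤m)) τ<t) (t≤m ∷ [])) ,
                       iso , τ<t)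
    ... | no t≰m = α-noR r Rr (Contains≅-map⁻ mono (All.map proj₁ α-bounds)
      (τ , ⊆-++-init (subst (τ ++ [ t ] ⊆_) (map-++ f α [ suc k ]) (in-high τ sub (≰⇒> t≰m))) , iso))

  Av-Rn-join : ∀ {k m α c β} → Av-R k α → Av-Rn m (c ∷ β) → 0 < k → Av-Rn (k + m) (join α (c ∷ β))
  Av-Rn-join (α↭ , α-av) (γ↭ , γ-av) k>0 with refl ← ↭-interval-length α↭ | refl ← ↭-interval-length γ↭ =
    Join.join-↭ α↭ γ↭ k>0 , join-avoids α↭ γ↭ k>0 α-av γ-av

  Av-Rn-split : ∀ {n α β} → Av-Rn (suc n) (α ++ suc n ∷ β) → 0 < length α →
    ∃₂ λ α₀ c → α ++ suc n ∷ β ≡ join α₀ (c ∷ β) × Av-R (length α) α₀ × Av-Rn (suc (length β)) (c ∷ β)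
  Av-Rn-split {n} {α} {β} (σ↭ , no4 , noCapped) k>0 =
    α₀ , c , σ≡join ,
    (α₀↭ , α₀-no4 , α₀-noR) ,
    (γ↭ , no4 ∘ Contains1243∨2143-⊆ γ⊆σ , λ r Rr → noCapped r Rr ∘ ContainsCapped-⊆ γ⊆σ)
    where
    open Decompose σ↭ no4 k>0
    mono : StrictlyMonotoneOn (0 <_) (lift c m)
    mono = lift-mono (proj₂ c∈α×c≤m)
    α₀-no4 : ¬ Contains1243∨2143 α₀
    α₀-no4 = no4 ∘ Contains1243∨2143-⊆ (Sublist.++⁺ʳ (N ∷ β) ⊆-refl) ∘ subst Contains1243∨2143 lift-α₀
               ∘ Contains1243∨2143-map⁺ mono α₀-positive
    α₀-noR : ∀ r → R r → ¬ Contains≅ α₀ r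
    α₀-noR r Rr α₀-contains
      with τ , τ⊆α , iso ← subst (λ xs → Contains≅ xs r) lift-α₀ (Contains≅-map⁺ mono α₀-positive α₀-contains) =
      noCapped r Rr (τ , N , Sublist.++⁺ τ⊆α (refl ∷ Sublist.[]⊆-universal β) , iso , Sublist.All-resp-⊆ τ⊆α α<N)

  module Counting (p q : ℕ → ℕ)
    (hp : ∀ n → HasCard (Av (With1243-2143 R) n) (p n))
    (hq : ∀ n → HasCard (Av (With1243-2143 (AppendMax R)) n) (q n)) where

    card-R : ∀ k → HasCard (Av-R k) (p k)
    card-R k = HasCard-resp (λ _ → Av⇔Av-R) (hp k)

    card-Rn : ∀ j → HasCard (Av-Rn j) (q j)
    card-Rn j = HasCard-resp (λ _ → Av⇔Av-Rn) (hq j)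

    Av-Rn-list : ℕ → List (List ℕ)
    Av-Rn-list j = proj₁ (card-Rn j)

    ∈-Av-Rn-list : ∀ {j γ} → γ ∈ Av-Rn-list j ⇔ Av-Rn j γ
    ∈-Av-Rn-list {j} {γ} = proj₂ (proj₂ (proj₂ (card-Rn j))) γ

    Joined : ℕ → ℕ → List ℕ → List ℕ → Set
    Joined n j γ σ = ∃ λ α → Av-R (suc n ∸ j) α × join α γ ≡ σ

    Decomposition : ℕ → List ℕ → Set
    Decomposition n σ = (∃ λ τ → Av-Rn n τ × suc n ∷ τ ≡ σ) ⊎
                (∃ λ j → j ∈ interval 0 n × ∃ λ γ → γ ∈ Av-Rn-list j × Joined n j γ σ)

    private
      index-bounds : ∀ {n j} → j ∈ interval 0 n → 0 < j × 0 < suc n ∸ j × suc n ∸ j + j ≡ suc n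
      index-bounds {n} {j} j∈ with 0<j , j≤n ← ∈-interval⁻ 0 n j∈ =
        0<j , m<n⇒0<n∸m (s≤s j≤n) , m∸n+n≡m (m≤n⇒m≤1+n j≤n)

      not-Av-Rn-[] : ∀ {n j} → j ∈ interval 0 n → ¬ Av-Rn j []
      not-Av-Rn-[] j∈ (γ↭ , _) = <-irrefl (↭-interval-length γ↭) (proj₁ (index-bounds j∈))

      positive : ∀ {n j α} → j ∈ interval 0 n → Av-R (suc n ∸ j) α → 0 < length α
      positive j∈ (α↭ , _) = subst (0 <_) (sym (↭-interval-length α↭)) (proj₁ (proj₂ (index-bounds j∈)))

    joined-injective : ∀ {n j j′ γ γ′ α α′} → j ∈ interval 0 n → j′ ∈ interval 0 n → Av-Rn j γ → Av-Rn j′ γ′ →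
      Av-R (suc n ∸ j) α → Av-R (suc n ∸ j′) α′ → join α γ ≡ join α′ γ′ → α ≡ α′ × γ ≡ γ′
    joined-injective {γ = []} j∈ _ γ-av = ⊥-elim (not-Av-Rn-[] j∈ γ-av)
    joined-injective {γ′ = []} _ j′∈ _ γ′-av = ⊥-elim (not-Av-Rn-[] j′∈ γ′-av)
    joined-injective {γ = _ ∷ _} {_ ∷ _} j∈ j′∈ (γ↭ , _) (γ′↭ , _) α-av α′-av =
      join-injective (↭-interval-self (proj₁ α-av)) (↭-interval-self γ↭) (positive j∈ α-av)
                     (↭-interval-self (proj₁ α′-av)) (↭-interval-self γ′↭) (positive j′∈ α′-av)

    decompose : ∀ {n} α β → Av-Rn (suc n) (α ++ suc n ∷ β) → Decomposition n (α ++ suc n ∷ β)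
    decompose [] β av = inj₁ (β , Av-Rn-cons-max⁻ av , refl)
    decompose {n} α@(_ ∷ _) β av@(σ↭ , _) = joined (Av-Rn-split av (s≤s z≤n))
      where
      m : ℕ
      m = suc (length β)
      k+m≡ : length α + m ≡ suc n
      k+m≡ = trans (sym (length-++ α)) (↭-interval-length σ↭)
      k≡ : suc n ∸ m ≡ length α
      k≡ = trans (cong (_∸ m) (sym k+m≡)) (m+n∸n≡m (length α) m)
      m≤n : m ≤ n
      m≤n = ≤-pred (subst (suc m ≤_) k+m≡ (+-monoˡ-≤ m (s≤s z≤n)))
      joined : (∃₂ λ α₀ c → α ++ suc n ∷ β ≡ join α₀ (c ∷ β) × Av-R (length α) α₀ × Av-Rn m (c ∷ β)) →
        Decomposition n (α ++ suc n ∷ β)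
      joined (α₀ , c , σ≡ , α₀-av , γ-av) =
        inj₂ (m , ∈-interval⁺ 0 n (s≤s z≤n) m≤n , c ∷ β , from ∈-Av-Rn-list γ-av , α₀ ,
              subst (λ k → Av-R k α₀) (sym k≡) α₀-av , sym σ≡)

    Av-Rn-suc⇒ : ∀ {n σ} → Av-Rn (suc n) σ → Decomposition n σ
    Av-Rn-suc⇒ {n} av@(σ↭ , _)
      with α , β , refl ← ∈-∃++ (∈-resp-↭ (↭-sym σ↭) (∈-interval⁺ 0 (suc n) (s≤s z≤n) ≤-refl)) =
      decompose α β av

    Av-Rn-suc⇐ : ∀ {n σ} → Decomposition n σ → Av-Rn (suc n) σ
    Av-Rn-suc⇐ (inj₁ (τ , τ-av , refl)) = Av-Rn-cons-max τ-av
    Av-Rn-suc⇐ (inj₂ (j , j∈ , [] , γ∈ , _)) = ⊥-elim (not-Av-Rn-[] j∈ (to ∈-Av-Rn-list γ∈))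
    Av-Rn-suc⇐ (inj₂ (j , j∈ , c ∷ β , γ∈ , α , α-av , refl)) =
      subst (λ N → Av-Rn N (join α (c ∷ β))) (proj₂ (proj₂ (index-bounds j∈)))
        (Av-Rn-join α-av (to ∈-Av-Rn-list γ∈) (proj₁ (proj₂ (index-bounds j∈))))

    card-joined : ∀ n {j} → j ∈ interval 0 n →
      HasCard (λ σ → ∃ λ γ → γ ∈ Av-Rn-list j × Joined n j γ σ) (q j * p (suc n ∸ j))
    card-joined n {j} j∈ = subst (HasCard _) count
      (HasCard-⋃ (Av-Rn-list j) (proj₁ (proj₂ (proj₂ (card-Rn j)))) card-image different-γ)
      where
      k : ℕ
      k = suc n ∸ j
      count : sum (map (λ _ → p k) (Av-Rn-list j)) ≡ q j * p k
      count = trans (sum-map-const (p k) (Av-Rn-list j)) (cong (_* p k) (proj₁ (proj₂ (card-Rn j))))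
      card-image : ∀ {γ} → γ ∈ Av-Rn-list j → HasCard (Joined n j γ) (p k)
      card-image {γ} γ∈ = HasCard-image (λ α → join α γ) (card-R k) λ α-av α′-av eq →
        proj₁ (joined-injective j∈ j∈ (to ∈-Av-Rn-list γ∈) (to ∈-Av-Rn-list γ∈) α-av α′-av eq)
      different-γ : ∀ {γ γ′ σ} → γ ∈ Av-Rn-list j → γ′ ∈ Av-Rn-list j → Joined n j γ σ → Joined n j γ′ σ → γ ≡ γ′
      different-γ γ∈ γ′∈ (α , α-av , refl) (α′ , α′-av , eq) =
        proj₂ (joined-injective j∈ j∈ (to ∈-Av-Rn-list γ∈) (to ∈-Av-Rn-list γ′∈) α-av α′-av (sym eq))

    card-decomposition : ∀ n → HasCard (Decomposition n) (q n + joinCount p q n)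
    card-decomposition n =
      HasCard-⊎ (HasCard-image (suc n ∷_) (card-Rn n) (λ _ _ → proj₂ ∘ ∷-injective))
                (HasCard-⋃ (interval 0 n) (interval-unique 0 n) (card-joined n) different-index)
                top-not-joined
      where
      different-index : ∀ {j j′ σ} → j ∈ interval 0 n → j′ ∈ interval 0 n →
        (∃ λ γ → γ ∈ Av-Rn-list j × Joined n j γ σ) → (∃ λ γ → γ ∈ Av-Rn-list j′ × Joined n j′ γ σ) → j ≡ j′
      different-index j∈ j′∈ (γ , γ∈ , α , α-av , refl) (γ′ , γ′∈ , α′ , α′-av , eq) = begin
        _            ≡⟨ ↭-interval-length (proj₁ γ-av) ⟨
        length γ     ≡⟨ cong length (proj₂ (joined-injective j∈ j′∈ γ-av γ′-av α-av α′-av (sym eq))) ⟩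
        length γ′    ≡⟨ ↭-interval-length (proj₁ γ′-av) ⟩
        _            ∎
        where
        open ≡-Reasoning
        γ-av : Av-Rn _ γ
        γ-av = to ∈-Av-Rn-list γ∈
        γ′-av : Av-Rn _ γ′
        γ′-av = to ∈-Av-Rn-list γ′∈
      top-not-joined : ∀ {σ} → (∃ λ τ → Av-Rn n τ × suc n ∷ τ ≡ σ) →
        ¬ (∃ λ j → j ∈ interval 0 n × ∃ λ γ → γ ∈ Av-Rn-list j × Joined n j γ σ)
      top-not-joined _ (j , j∈ , [] , γ∈ , _) = not-Av-Rn-[] j∈ (to ∈-Av-Rn-list γ∈)
      top-not-joined (τ , _ , refl) (j , j∈ , c ∷ β , γ∈ , α , α-av , eq) =
        join-head (↭-interval-self (proj₁ α-av)) (↭-interval-self γ↭) (positive j∈ α-av)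
          (trans eq (cong (_∷ τ) (sym k+j≡)))
        where
        γ↭ : c ∷ β ↭ interval 0 j
        γ↭ = proj₁ (to ∈-Av-Rn-list γ∈)
        k+j≡ : length α + suc (length β) ≡ suc n
        k+j≡ = trans (cong₂ _+_ (↭-interval-length (proj₁ α-av)) (↭-interval-length γ↭))
                     (proj₂ (proj₂ (index-bounds j∈)))

    recurrence : ∀ n → q (suc n) ≡ q n + joinCount p q n
    recurrence n = HasCard-unique (card-Rn (suc n)) (card-decomposition n) (λ _ → mk⇔ Av-Rn-suc⇒ Av-Rn-suc⇐)

    card-[] : HasCard (_≡ []) 1
    card-[] = [] ∷ [] , refl , [] ∷ [] , λ _ → mk⇔ (λ { (here refl) → refl }) (λ { refl → here refl })

    p₀ : p 0 ≡ 1
    p₀ = HasCard-unique (card-R 0) card-[] (λ _ → Av-R-zero)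

    q₀ : q 0 ≡ 1
    q₀ = HasCard-unique (card-Rn 0) card-[] (λ _ → Av-Rn-zero)

-- Coefficients of the generating functions

module _ where
  open import Data.Integer using (ℤ) renaming (_+_ to _+ᶻ_; _*_ to _*ᶻ_; _-_ to _-ᶻ_)
  import Data.Integer.Properties as ℤ
  open import Data.Integer.Tactic.RingSolver using (solve-∀)

  Σᶻ : (ℕ → ℤ) → List ℕ → ℤ
  Σᶻ f ks = foldr _+ᶻ_ (+ 0) (map f ks)

  Σᶻ-cong : ∀ {f g : ℕ → ℤ} ks → (∀ {k} → k ∈ ks → f k ≡ g k) → Σᶻ f ks ≡ Σᶻ g ks
  Σᶻ-cong [] _ = refl
  Σᶻ-cong (k ∷ ks) f≗g = cong₂ _+ᶻ_ (f≗g (here refl)) (Σᶻ-cong ks (f≗g ∘ there))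

  Σᶻ-zero : ∀ {f : ℕ → ℤ} ks → (∀ {k} → k ∈ ks → f k ≡ + 0) → Σᶻ f ks ≡ + 0
  Σᶻ-zero [] _ = refl
  Σᶻ-zero (k ∷ ks) f≗0 = cong₂ _+ᶻ_ (f≗0 (here refl)) (Σᶻ-zero ks (f≗0 ∘ there))

  Σᶻ-++ : ∀ (f : ℕ → ℤ) ks ls → Σᶻ f (ks ++ ls) ≡ Σᶻ f ks +ᶻ Σᶻ f ls
  Σᶻ-++ f [] ls = sym (ℤ.+-identityˡ _)
  Σᶻ-++ f (k ∷ ks) ls = trans (cong (f k +ᶻ_) (Σᶻ-++ f ks ls)) (sym (ℤ.+-assoc (f k) _ _))

  Σᶻ-- : ∀ (f g : ℕ → ℤ) ks → Σᶻ (λ k → f k -ᶻ g k) ks ≡ Σᶻ f ks -ᶻ Σᶻ g ks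
  Σᶻ-- f g [] = refl
  Σᶻ-- f g (k ∷ ks) = trans (cong (f k -ᶻ g k +ᶻ_) (Σᶻ-- f g ks)) (regroup (f k) (g k) (Σᶻ f ks) (Σᶻ g ks))
    where
    regroup : ∀ a b c d → a -ᶻ b +ᶻ (c -ᶻ d) ≡ a +ᶻ c -ᶻ (b +ᶻ d)
    regroup = solve-∀

  Σᶻ-+ : ∀ (a : ℕ → ℕ) ks → Σᶻ (λ k → + a k) ks ≡ + sum (map a ks)
  Σᶻ-+ a [] = refl
  Σᶻ-+ a (k ∷ ks) = trans (cong (+ a k +ᶻ_) (Σᶻ-+ a ks)) (sym (ℤ.pos-+ (a k) _))

  ⊛-⊖ : ∀ (f g h : FPS) n → (f ⊛ (g ⊖ h)) n ≡ (f ⊛ g) n -ᶻ (f ⊛ h) n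
  ⊛-⊖ f g h n = trans (Σᶻ-cong (upTo (suc n)) λ {k} _ → distrib (f k) (g (n ∸ k)) (h (n ∸ k)))
                      (Σᶻ-- (λ k → f k *ᶻ g (n ∸ k)) (λ k → f k *ᶻ h (n ∸ k)) (upTo (suc n)))
    where
    distrib : ∀ a b c → a *ᶻ (b -ᶻ c) ≡ a *ᶻ b -ᶻ a *ᶻ c
    distrib = solve-∀

  Σᶻ-upTo-suc : ∀ (f : ℕ → ℤ) n → Σᶻ f (upTo (suc n)) ≡ Σᶻ f (upTo n) +ᶻ f n
  Σᶻ-upTo-suc f n = begin
    Σᶻ f (upTo (suc n))               ≡⟨ cong (Σᶻ f) (sym (applyUpTo-∷ʳ id n)) ⟩
    Σᶻ f (upTo n ++ [ n ])            ≡⟨ Σᶻ-++ f (upTo n) [ n ] ⟩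
    Σᶻ f (upTo n) +ᶻ (f n +ᶻ + 0)     ≡⟨ cong (Σᶻ f (upTo n) +ᶻ_) (ℤ.+-identityʳ (f n)) ⟩
    Σᶻ f (upTo n) +ᶻ f n              ∎
    where open ≡-Reasoning

  ⊛-last : ∀ (f g : FPS) n → (f ⊛ g) n ≡ Σᶻ (λ k → f k *ᶻ g (n ∸ k)) (upTo n) +ᶻ f n *ᶻ g 0
  ⊛-last f g n = trans (Σᶻ-upTo-suc term n) (cong (λ z → Σᶻ term (upTo n) +ᶻ f n *ᶻ g z) (n∸n≡0 n))
    where
    term : ℕ → ℤ
    term k = f k *ᶻ g (n ∸ k)

  ⊛-constS : ∀ (f : FPS) c n → (f ⊛ constS c) n ≡ f n *ᶻ c
  ⊛-constS f c n = begin
    (f ⊛ constS c) n                                        ≡⟨ ⊛-last f (constS c) n ⟩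
    Σᶻ (λ k → f k *ᶻ constS c (n ∸ k)) (upTo n) +ᶻ f n *ᶻ c ≡⟨ cong (_+ᶻ f n *ᶻ c) (Σᶻ-zero (upTo n) vanish) ⟩
    + 0 +ᶻ f n *ᶻ c                                        ≡⟨ ℤ.+-identityˡ _ ⟩
    f n *ᶻ c ∎
    where
    open ≡-Reasoning
    vanish : ∀ {k} → k ∈ upTo n → f k *ᶻ constS c (n ∸ k) ≡ + 0
    vanish {k} k∈ with n ∸ k | m<n⇒0<n∸m (∈-upTo⁻ k∈)
    ... | suc _ | _ = ℤ.*-zeroʳ (f k)

  ⊛-X-zero : ∀ (f : FPS) → (f ⊛ X) 0 ≡ + 0
  ⊛-X-zero f = trans (ℤ.+-identityʳ _) (ℤ.*-zeroʳ (f 0))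

  ⊛-X-suc : ∀ (f : FPS) n → (f ⊛ X) (suc n) ≡ f n
  ⊛-X-suc f n = begin
    (f ⊛ X) (suc n)                                   ≡⟨ ⊛-last f X (suc n) ⟩
    Σᶻ term (upTo (suc n)) +ᶻ f (suc n) *ᶻ + 0
      ≡⟨ cong₂ _+ᶻ_ (Σᶻ-upTo-suc term n) (ℤ.*-zeroʳ (f (suc n))) ⟩
    Σᶻ term (upTo n) +ᶻ f n *ᶻ X (suc n ∸ n) +ᶻ + 0
      ≡⟨ cong₂ (λ s j → s +ᶻ f n *ᶻ X j +ᶻ + 0) (Σᶻ-zero (upTo n) vanish) (m+n∸n≡m 1 n) ⟩
    + 0 +ᶻ f n *ᶻ + 1 +ᶻ + 0                           ≡⟨ unit (f n) ⟩
    f n                                                ∎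
    where
    open ≡-Reasoning
    term : ℕ → ℤ
    term k = f k *ᶻ X (suc n ∸ k)
    vanish : ∀ {k} → k ∈ upTo n → term k ≡ + 0
    vanish {k} k∈ with suc n ∸ k | +-∸-assoc 1 (<⇒≤ (∈-upTo⁻ k∈)) | m<n⇒0<n∸m (∈-upTo⁻ k∈)
    ... | suc (suc _) | _ | _ = ℤ.*-zeroʳ (f k)
    ... | suc zero | eq | pos = ⊥-elim (<-irrefl (suc-injective eq) pos)
    unit : ∀ a → + 0 +ᶻ a *ᶻ + 1 +ᶻ + 0 ≡ a
    unit = solve-∀

  gf-⊛-gf : ∀ (a b : ℕ → ℕ) n → (gf a ⊛ gf b) n ≡ + sum (map (λ k → a k * b (n ∸ k)) (upTo (suc n)))
  gf-⊛-gf a b n = trans (Σᶻ-cong (upTo (suc n)) λ {k} _ → sym (ℤ.pos-* (a k) (b (n ∸ k))))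
                        (Σᶻ-+ (λ k → a k * b (n ∸ k)) (upTo (suc n)))

  module Coefficients (p q : ℕ → ℕ) (p₀ : p 0 ≡ 1) (q₀ : q 0 ≡ 1) where

    convolution : ℕ → ℕ
    convolution n = sum (map (λ k → q k * p (n ∸ k)) (upTo (suc n)))

    convolution-suc : ∀ n → convolution (suc n) ≡ p (suc n) + (joinCount p q n + q (suc n))
    convolution-suc n = begin
      convolution N                                        ≡⟨ cong (sum-of ∘ map term) (map-upTo suc N) ⟨
      sum-of (map term (map suc (upTo N)))                 ≡⟨ cong (sum-of ∘ map term) (map-suc-upTo N) ⟩
      sum-of (map term (interval 0 N))                     ≡⟨ cong (sum-of ∘ map term) (interval-suc 0 n) ⟩
      sum-of (map term (interval 0 n ++ [ N ]))            ≡⟨ cong sum-of (map-++ term (interval 0 n) [ N ]) ⟩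
      sum-of (map term (interval 0 n) ++ [ term N ])
        ≡⟨ cong (_+_ (term 0)) (sum-++ (map term (interval 0 n)) _) ⟩
      term 0 + (joinCount p q n + (term N + 0))            ≡⟨ cong₂ (λ a b → a + (joinCount p q n + b)) term₀ termN ⟩
      p N + (joinCount p q n + q N)                        ∎
      where
      open ≡-Reasoning
      N : ℕ
      N = suc n
      term : ℕ → ℕ
      term k = q k * p (N ∸ k)
      sum-of : List ℕ → ℕ
      sum-of ks = term 0 + sum ks
      term₀ : term 0 ≡ p N
      term₀ = trans (cong (_* p N) q₀) (+-identityʳ (p N))
      termN : term N + 0 ≡ q N
      termN = begin
        q N * p (N ∸ N) + 0   ≡⟨ +-identityʳ _ ⟩
        q N * p (N ∸ N)       ≡⟨ cong (λ j → q N * p j) (n∸n≡0 N) ⟩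
        q N * p 0             ≡⟨ cong (q N *_) p₀ ⟩
        q N * 1               ≡⟨ *-identityʳ (q N) ⟩
        q N                   ∎

    coefficient : ∀ n → (gf q ⊛ ((constS (+ 2) ⊖ X) ⊖ gf p)) n ≡
      + q n *ᶻ + 2 -ᶻ (gf q ⊛ X) n -ᶻ + convolution n
    coefficient n = begin
      (gf q ⊛ ((constS (+ 2) ⊖ X) ⊖ gf p)) n
        ≡⟨ ⊛-⊖ (gf q) (constS (+ 2) ⊖ X) (gf p) n ⟩
      (gf q ⊛ (constS (+ 2) ⊖ X)) n -ᶻ (gf q ⊛ gf p) n
        ≡⟨ cong₂ _-ᶻ_ (⊛-⊖ (gf q) (constS (+ 2)) X n) (gf-⊛-gf q p n) ⟩
      (gf q ⊛ constS (+ 2)) n -ᶻ (gf q ⊛ X) n -ᶻ + convolution n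
        ≡⟨ cong (λ z → z -ᶻ (gf q ⊛ X) n -ᶻ + convolution n) (⊛-constS (gf q) (+ 2) n) ⟩
      + q n *ᶻ + 2 -ᶻ (gf q ⊛ X) n -ᶻ + convolution n
        ∎
      where open ≡-Reasoning

    recurrence⇒gf-equation : (∀ n → q (suc n) ≡ q n + joinCount p q n) →
      ∀ n → (gf q ⊛ ((constS (+ 2) ⊖ X) ⊖ gf p)) n ≡ (constS (+ 2) ⊖ gf p) n
    recurrence⇒gf-equation _ zero
      rewrite coefficient 0 | ⊛-X-zero (gf q) | p₀ | q₀ = refl
    recurrence⇒gf-equation recurrence (suc n)
      rewrite coefficient (suc n) | ⊛-X-suc (gf q) n | convolution-suc n | recurrence n
      = cancel (q n) (joinCount p q n) (p (suc n))
      where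
      cancel : ∀ a s b → + (a + s) *ᶻ + 2 -ᶻ + a -ᶻ + (b + (s + (a + s))) ≡ + 0 -ᶻ + b
      cancel a s b rewrite ℤ.pos-+ b (s + (a + s)) | ℤ.pos-+ s (a + s) | ℤ.pos-+ a s =
        identity (+ a) (+ s) (+ b)
        where
        identity : ∀ a s b → (a +ᶻ s) *ᶻ + 2 -ᶻ a -ᶻ (b +ᶻ (s +ᶻ (a +ᶻ s))) ≡ + 0 -ᶻ b
        identity = solve-∀

theorem6p8 : (R : List ℕ → Set) → (∃ λ σ → R σ) →
    (∀ σ → R σ → IsPerm σ × 1 ≤ length σ) →
    (p q : ℕ → ℕ) →
    (∀ n → HasCard (Av (With1243-2143 R) n) (p n)) →
    (∀ n → HasCard (Av (With1243-2143 (AppendMax R)) n) (q n)) →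
    ∀ n → (gf q ⊛ ((constS (+ 2) ⊖ X) ⊖ gf p)) n ≡ (constS (+ 2) ⊖ gf p) n
theorem6p8 R _ R-perm p q hp hq =
  Coefficients.recurrence⇒gf-equation p q counting.p₀ counting.q₀ counting.recurrence
  where module counting = Counting R R-perm p q hp hq
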